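{- Let $\mathsf{D}$ be an optiongraph, let $\mathsf{C}$ be a suboptiongraph of $\mathsf{D}$, and let $\theta$ be a congruence relation on $\mathsf{D}$. Then $\tilde{\mathsf{C}}:=\{[p]\in\mathsf{D}/\theta\mid [p]\cap\mathsf{C}\neq\emptyset\}$ is a suboptiongraph of $\mathsf{D}/\theta$ and it is isomorphic to $\mathsf{C}/\theta_{|\mathsf{C}}$, where $\theta_{|\mathsf{C}}=\theta\cap(\mathsf{C}\times\mathsf{C})$ is the restriction of $\theta$ to $\mathsf{C}$.
   Context: An optiongraph is a nonempty set $\mathsf{D}$ (of positions, possibly infinite) together with an option function $\mathrm{Opt}_{\mathsf{D}}:\mathsf{D}\to 2^{\mathsf{D}}$. A function $f:\mathsf{C}\to\mathsf{D}$ between optiongraphs is option preserving if $\mathrm{Opt}_{\mathsf{D}}(f(p))=f(\mathrm{Opt}_{\mathsf{C}}(p))$ for all $p\in\mathsf{C}$; an isomorphism is a bijective option-preserving map. A suboptiongraph of $\mathsf{D}$ is a nonempty subset $\mathsf{C}\subseteq\mathsf{D}$ with option function such that the inclusion map is option preserving (equivalently, $\mathrm{Opt}_{\mathsf{D}}(p)\subseteq\mathsf{C}$ and $\mathrm{Opt}_{\mathsf{C}}(p)=\mathrm{Opt}_{\mathsf{D}}(p)$ for $p\in\mathsf{C}$). For an equivalence relation $\theta$ on $\mathsf{D}$, write $[p]$ for the class of $p$ and $[S]:=\{[s]\mid s\in S\}$. An equivalence relation $\theta$ on $\mathsf{D}$ is a congruence relation if $p\mathrel{\theta}q$ implies $[\mathrm{Opt}(p)]=[\mathrm{Opt}(q)]$.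 For a congruence relation $\theta$, the quotient optiongraph $\mathsf{D}/\theta$ is the set of classes with option function $\mathrm{Opt}_{\mathsf{D}/\theta}([p]):=[\mathrm{Opt}_{\mathsf{D}}(p)]$. -}

module Defs where

open import Level using (0ℓ)
open import Data.Product using (Σ; ∃; _×_; _,_; proj₁; proj₂)
open import Function using (_⇔_)
open import Relation.Unary using (Pred; _⊆_)
open import Relation.Binary using (Rel; IsEquivalence)
open import Relation.Binary.PropositionalEquality as P using (_≡_; refl)

-- Since Agda (without cubical) has no quotient types, an optiongraph is
-- represented on a setoid: a carrier type with an equivalence relation
-- playing the role of equality of positions.
-- The paper's optiongraphs (plain sets) are the special case where the
-- equivalence is propositional equality, see `plainOG`.

_≐_ : {A : Set} → Pred A 0ℓ → Pred A 0ℓ → Set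
S ≐ T = ∀ x → S x ⇔ T x

record Optiongraph : Set₁ where
  field
    Pos     : Set
    _≈_     : Rel Pos 0ℓ
    isEquiv : IsEquivalence _≈_
    -- Opt p q  means  q ∈ Opt(p)
    Opt     : Pos → Pred Pos 0ℓ
    -- option sets are sets of positions (closed under ≈)
    Opt-closed : ∀ {p q q'} → q ≈ q' → Opt p q → Opt p q'
    Opt-resp   : ∀ {p p'} → p ≈ p' → Opt p ≐ Opt p'
    -- nonempty
    point   : Pos

open Optiongraph

plainOG : (D : Set) → (D → Pred D 0ℓ) → D → Optiongraph
plainOG D O d = record
  { Pos = D ; _≈_ = _≡_ ; isEquiv = P.isEquivalence ; Opt = O
  ; Opt-closed = λ { refl s → s }
  ; Opt-resp = λ { refl x → record { to = λ s → s ; from = λ s → s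
                                    ; to-cong = λ { refl → refl }
                                    ; from-cong = λ { refl → refl } } }
  ; point = d }

image : (G H : Optiongraph) → (Pos G → Pos H) → Pred (Pos G) 0ℓ → Pred (Pos H) 0ℓ
image G H f S y = ∃ λ x → S x × _≈_ H y (f x)

record OptionPreserving (G H : Optiongraph) (f : Pos G → Pos H) : Set where
  field
    f-resp : ∀ {p q} → _≈_ G p q → _≈_ H (f p) (f q)
    preserves : ∀ p → Opt H (f p) ≐ image G H f (Opt G p)

record IsIsomorphism (G H : Optiongraph) (f : Pos G → Pos H) : Set where
  field
    optionPreserving : OptionPreserving G H f
    injective  : ∀ {p q} → _≈_ H (f p) (f q) → _≈_ G p q
    surjective : ∀ y → ∃ λ x → _≈_ H (f x) y

Isomorphic : Optiongraph → Optiongraph → Set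
Isomorphic G H = ∃ λ (f : Pos G → Pos H) → IsIsomorphism G H f

record IsSuboptiongraph (G : Optiongraph) (C : Pred (Pos G) 0ℓ) : Set₁ where
  field
    C-closed : ∀ {p q} → _≈_ G p q → C p → C q
    elem     : Σ (Pos G) C
    OptC     : Σ (Pos G) C → Pred (Σ (Pos G) C) 0ℓ
    OptC-closed : ∀ {p q q'} → _≈_ G (proj₁ q) (proj₁ q') → OptC p q → OptC p q'
    OptC-resp   : ∀ {p p'} → _≈_ G (proj₁ p) (proj₁ p') → OptC p ≐ OptC p'

  asOG : Optiongraph
  asOG = record
    { Pos = Σ (Pos G) C
    ; _≈_ = λ a b → _≈_ G (proj₁ a) (proj₁ b)
    ; isEquiv = record { refl = IsEquivalence.refl (isEquiv G)
                       ; sym = IsEquivalence.sym (isEquiv G)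
                       ; trans = IsEquivalence.trans (isEquiv G) }
    ; Opt = OptC ; Opt-closed = OptC-closed ; Opt-resp = OptC-resp
    ; point = elem }

  field
    inclusion-preserving : OptionPreserving asOG G proj₁

classes : {A : Set} → Rel A 0ℓ → Pred A 0ℓ → Pred A 0ℓ
classes θ S x = ∃ λ s → S s × θ s x

record IsCongruence (G : Optiongraph) (θ : Rel (Pos G) 0ℓ) : Set where
  field
    isEquivθ : IsEquivalence θ
    ≈⇒θ      : ∀ {p q} → _≈_ G p q → θ p q
    cong     : ∀ {p q} → θ p q → classes θ (Opt G p) ≐ classes θ (Opt G q)

quotient : (G : Optiongraph) (θ : Rel (Pos G) 0ℓ) → IsCongruence G θ → Optiongraph
quotient G θ κ = record
  { Pos = Pos G ; _≈_ = θ ; isEquiv = isEquivθ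
  ; Opt = λ p → classes θ (Opt G p)
  ; Opt-closed = λ { q≈q' (s , s∈ , sθq) → s , s∈ , IsEquivalence.trans isEquivθ sθq q≈q' }
  ; Opt-resp = cong
  ; point = point G }
  where open IsCongruence κ

restrict : (G : Optiongraph) (C : Pred (Pos G) 0ℓ) → Rel (Pos G) 0ℓ → Rel (Σ (Pos G) C) 0ℓ
restrict G C θ a b = θ (proj₁ a) (proj₁ b)

-- C̃ = { [p] | [p] ∩ C ≠ ∅ }, as a θ-saturated subset of positions
tilde : {A : Set} → Rel A 0ℓ → Pred A 0ℓ → Pred A 0ℓ
tilde θ C p = ∃ λ c → C c × θ p c

{-# OPTIONS --safe #-}
-- A suboptiongraph C contains the options of its positions, and its own options
-- are exactly those of D; so [Opt(c)] computed in C or in D agree for c ∈ C.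
-- The isomorphism C̃ → C/θ|C sends [p] to [c] for any c ∈ C with p θ c; it is
-- option preserving because p θ c gives [Opt(p)] = [Opt(c)].
module Submission where

open import Defs
open import Level using (0ℓ)
open import Data.Product using (Σ; _,_; proj₁; proj₂)
open import Function.Bundles using (_⇔_; mk⇔; Equivalence)
open import Function.Properties.Equivalence as ⇔ using ()
open import Relation.Unary using (Pred; _⊆_)
open import Relation.Binary using (Rel; IsEquivalence)

open Optiongraph
open Equivalence using (to; from)

module SuboptiongraphProperties
  {G : Optiongraph} {C : Pred (Pos G) 0ℓ} (subC : IsSuboptiongraph G C) where

  open IsSuboptiongraph subC
  open OptionPreserving inclusion-preserving
  module G = IsEquivalence (isEquiv G)

  Opt⊆ : (p : Σ (Pos G) C) → Opt G (proj₁ p) ⊆ C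
  Opt⊆ p o with to (preserves p _) o
  ... | q , _ , y≈q = C-closed (G.sym y≈q) (proj₂ q)

  OptC⇔Opt : (p q : Σ (Pos G) C) → OptC p q ⇔ Opt G (proj₁ p) (proj₁ q)
  OptC⇔Opt p q = mk⇔
    (λ o → from (preserves p (proj₁ q)) (q , o , G.refl))
    (λ o → let (q' , o' , q≈q') = to (preserves p (proj₁ q)) o
           in OptC-closed (G.sym q≈q') o')

module _
  {G : Optiongraph} {C : Pred (Pos G) 0ℓ} (subC : IsSuboptiongraph G C)
  {θ : Rel (Pos G) 0ℓ} (κ : IsCongruence G θ) where

  open IsSuboptiongraph subC using (OptC; elem; asOG)
  open SuboptiongraphProperties subC
  open IsCongruence κ
  module θ = IsEquivalence isEquivθ

  θ∣C : Rel (Σ (Pos G) C) 0ℓ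
  θ∣C = restrict G C θ

  classes-restrict⇔ : (p x : Σ (Pos G) C) →
    classes θ∣C (OptC p) x ⇔ classes θ (Opt G (proj₁ p)) (proj₁ x)
  classes-restrict⇔ p x = mk⇔
    (λ (s , o , sθx) → proj₁ s , to (OptC⇔Opt p s) o , sθx)
    (λ (s , o , sθx) → let s∈C = Opt⊆ p o
                        in (s , s∈C) , from (OptC⇔Opt p (s , s∈C)) o , sθx)

  restrict-isCongruence : IsCongruence asOG θ∣C
  restrict-isCongruence = record
    { isEquivθ = record { refl = θ.refl ; sym = θ.sym ; trans = θ.trans }
    ; ≈⇒θ      = ≈⇒θ
    ; cong     = λ {p} {q} pθq x →
        ⇔.trans (classes-restrict⇔ p x)
          (⇔.trans (cong pθq (proj₁ x)) (⇔.sym (classes-restrict⇔ q x)))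
    }

  C̃ : Pred (Pos G) 0ℓ
  C̃ = tilde θ C

  classes-Opt⊆C̃ : {p : Pos G} → C̃ p → classes θ (Opt G p) ⊆ C̃
  classes-Opt⊆C̃ (c , c∈C , pθc) cl =
    let (s , o , sθy) = to (cong pθc _) cl
    in s , Opt⊆ (c , c∈C) o , θ.sym sθy

  C̃-isSuboptiongraph : IsSuboptiongraph (quotient G θ κ) C̃
  C̃-isSuboptiongraph = record
    { C-closed    = λ { pθq (c , c∈C , pθc) → c , c∈C , θ.trans (θ.sym pθq) pθc }
    ; elem        = proj₁ elem , proj₁ elem , proj₂ elem , θ.refl
    ; OptC        = λ p q → classes θ (Opt G (proj₁ p)) (proj₁ q)
    ; OptC-closed = Opt-closed (quotient G θ κ)
    ; OptC-resp   = λ pθp' x → cong pθp' (proj₁ x)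
    ; inclusion-preserving = record
      { f-resp    = λ pθq → pθq
      ; preserves = λ p y → mk⇔
          (λ cl → (y , classes-Opt⊆C̃ (proj₂ p) cl) , cl , θ.refl)
          (λ (x , cl , yθx) → Opt-closed (quotient G θ κ) (θ.sym yθx) cl)
      }
    }

  C̃ᴼᴳ : Optiongraph
  C̃ᴼᴳ = IsSuboptiongraph.asOG C̃-isSuboptiongraph

  C/θ∣C : Optiongraph
  C/θ∣C = quotient asOG θ∣C restrict-isCongruence

  embed : Σ (Pos G) C → Σ (Pos G) C̃
  embed (c , c∈C) = c , c , c∈C , θ.refl

  representative : Σ (Pos G) C̃ → Σ (Pos G) C
  representative (_ , c , c∈C , _) = c , c∈C

  representative-θ : (p : Σ (Pos G) C̃) → θ (proj₁ p) (proj₁ (representative p))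
  representative-θ (_ , _ , _ , pθc) = pθc

  image-representative⇔ : (p : Σ (Pos G) C̃) (y : Σ (Pos G) C) →
    image C̃ᴼᴳ C/θ∣C representative (Opt C̃ᴼᴳ p) y
      ⇔ classes θ (Opt G (proj₁ p)) (proj₁ y)
  image-representative⇔ p y = mk⇔
    (λ (x , cl , yθx) → Opt-closed (quotient G θ κ)
                          (θ.sym (θ.trans yθx (θ.sym (representative-θ x)))) cl)
    (λ cl → embed y , cl , θ.refl)

  representative-isIsomorphism : IsIsomorphism C̃ᴼᴳ C/θ∣C representative
  representative-isIsomorphism = record
    { optionPreserving = record
      { f-resp    = λ {p} {q} pθq →
          θ.trans (θ.sym (representative-θ p)) (θ.trans pθq (representative-θ q))
      ; preserves = λ p y → ⇔.trans (classes-restrict⇔ (representative p) y)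
          (⇔.trans (⇔.sym (cong (representative-θ p) (proj₁ y)))
            (⇔.sym (image-representative⇔ p y)))
      }
    ; injective  = λ {p} {q} t →
        θ.trans (representative-θ p) (θ.trans t (θ.sym (representative-θ q)))
    ; surjective = λ y → embed y , θ.refl
    }

mainTheorem2 : (D : Set) (OptD : D → Pred D 0ℓ) (d : D) →
    let 𝔻 = plainOG D OptD d in
    (C : Pred D 0ℓ) (subC : IsSuboptiongraph 𝔻 C) →
    (θ : Rel D 0ℓ) (κ : IsCongruence 𝔻 θ) →
    Σ (IsSuboptiongraph (quotient 𝔻 θ κ) (tilde θ C)) λ subC̃ →
      Σ (IsCongruence (IsSuboptiongraph.asOG subC) (restrict 𝔻 C θ)) λ κC →
        Isomorphic (IsSuboptiongraph.asOG subC̃)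
                   (quotient (IsSuboptiongraph.asOG subC) (restrict 𝔻 C θ) κC)
mainTheorem2 D OptD d C subC θ κ =
    C̃-isSuboptiongraph subC κ
  , restrict-isCongruence subC κ
  , representative subC κ
  , representative-isIsomorphism subC κ
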